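{- For $N\geq 1$, let $C_N\subseteq\mathcal{M}$ be the set of mutation classes of quivers that are mutation $N$-abundant, i.e. in every quiver of the class there are at least $N$ arrows between every pair of distinct vertices (the one-vertex quiver is included in every $C_N$), and let $E_N\subseteq\mathcal{M}$ be the set of $[I_{N+1}]$-avoiding mutation classes, where $I_{N+1}$ is the quiver on $N+1$ vertices with no arrows. Then all $C_N$ and $E_N$ are closed in the mutation class topology, $C_1=E_1$, and there is a bi-infinite chain of closed sets with all inclusions strict $$\cdots\subsetneq C_3\subsetneq C_2\subsetneq C_1=E_1\subsetneq E_2\subsetneq E_3\subsetneq\cdots.$$ Consequently $\mathcal{M}$ satisfies neither the ascending nor the descending chain condition on closed sets, and so $\mathcal{M}$ is not Noetherian.
   Context: A quiver is a finite directed multigraph (with at least one vertex) without loops and without oriented 2-cycles, with vertices labeled $1,\dots,n$. For a vertex $k$, the mutation $\mu_k(Q)$ is obtained by: (1) for each oriented path $i\to k\to j$ adding an arrow $i\to j$; (2) reversing all arrows incident to $k$; (3) removing a maximal collection of pairwise-disjoint oriented 2-cycles created. Two quivers are mutation-equivalent if one is isomorphic to a quiver obtained from the other by a finite sequence of mutations; the mutation class $[Q]$ is the equivalence class of $Q$. For $I\subseteq[n]$, the full subquiver $Q_I$ has vertex set $I$ and all arrows of $Q$ between vertices of $I$. A mutation class $[P]$ embeds into $[Q]$, written $[P]\preceq[Q]$, if some $P'\in[P]$ is isomorphic to a full subquiver of some $Q'\in[Q]$; this is a partial order on the set $\mathcal{M}$ of all mutation classes. The mutation class topology on $\mathcal{M}$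 is the Alexandrov topology of $\preceq$: closed sets are the down-sets, open sets are the up-sets. A mutation class $[Q]$ is $[P]$-avoiding if $[P]$ does not embed into $[Q]$. A topological space is Noetherian if every descending chain $C_1\supseteq C_2\supseteq\cdots$ of closed sets stabilizes. -}

module Defs where

open import Data.Nat using (ℕ; zero; suc; _+_; _*_; _∸_; _≤_)
open import Data.Fin using (Fin; _≟_)
open import Data.List using (List; []; _∷_)
open import Data.Product using (Σ; _×_; ∃; _,_)
open import Data.Sum using (_⊎_)
open import Relation.Nullary using (¬_; yes; no)
open import Relation.Binary.PropositionalEquality using (_≡_)
open import Function.Bundles using (_↔_; Inverse)
open import Function.Definitions using (Injective)

-- Arrow-count data on n vertices: arr i j = number of arrows i → j.
Raw : ℕ → Set
Raw n = Fin n → Fin n → ℕ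

record Quiver : Set where
  constructor mkQuiver
  field
    size     : ℕ
    nonEmpty : 1 ≤ size
    arr      : Raw size
    loopless : ∀ i → arr i i ≡ 0
    no2cycle : ∀ i j → arr i j ≡ 0 ⊎ arr j i ≡ 0
open Quiver public

-- Mutation at vertex k: arrows at k are reversed; for i,j ≠ k the arrows
-- i→j gain a(i,k)·a(k,j) new arrows (paths i→k→j), and then a maximal
-- collection of 2-cycles between i and j is cancelled.
mutateRaw : ∀ {n} → Fin n → Raw n → Raw n
mutateRaw k a i j with i ≟ k | j ≟ k
... | yes _ | _     = a j i
... | no _  | yes _ = a j i
... | no _  | no _  = (a i j + a i k * a k j) ∸ (a j i + a j k * a k i)

mutateSeq : ∀ {n} → List (Fin n) → Raw n → Raw n
mutateSeq []       a = a
mutateSeq (k ∷ ks) a = mutateSeq ks (mutateRaw k a)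

RawIso : ∀ {m n} → Raw m → Raw n → Set
RawIso {m} {n} a b =
  Σ (Fin m ↔ Fin n) λ σ → ∀ i j → b (Inverse.to σ i) (Inverse.to σ j) ≡ a i j

MutEq : Quiver → Quiver → Set
MutEq P Q = ∃ λ (ks : List (Fin (size P))) → RawIso (mutateSeq ks (arr P)) (arr Q)

IsoFullSub : Quiver → Quiver → Set
IsoFullSub P Q =
  Σ (Fin (size P) → Fin (size Q)) λ ι →
    Injective _≡_ _≡_ ι × (∀ i j → arr Q (ι i) (ι j) ≡ arr P i j)

Embeds : Quiver → Quiver → Set
Embeds P Q = Σ Quiver λ P' → Σ Quiver λ Q' →
  MutEq P P' × MutEq Q Q' × IsoFullSub P' Q'

-- Subsets of the set M of mutation classes are represented by predicates
-- on quivers (the ones considered below are invariant under mutation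
-- equivalence).
QSet : Set₁
QSet = Quiver → Set

_⊆_ : QSet → QSet → Set
A ⊆ B = ∀ Q → A Q → B Q

_≐_ : QSet → QSet → Set
A ≐ B = (A ⊆ B) × (B ⊆ A)

_⊊_ : QSet → QSet → Set
A ⊊ B = (A ⊆ B) × (∃ λ Q → B Q × ¬ A Q)

-- Closed in the mutation class topology = down-set for ⪯.
Closed : QSet → Set
Closed S = ∀ P Q → Embeds P Q → S Q → S P

C : ℕ → QSet
C N Q = ∀ Q' → MutEq Q Q' → ∀ i j → ¬ (i ≡ j) → N ≤ arr Q' i j + arr Q' j i

emptyQuiver : (m : ℕ) → 1 ≤ m → Quiver
emptyQuiver m p = mkQuiver m p (λ _ _ → 0) (λ _ → _≡_.refl) (λ _ _ → _⊎_.inj₁ _≡_.refl)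

E : ℕ → QSet
E N Q = ¬ Embeds (emptyQuiver (suc N) (Data.Nat.s≤s Data.Nat.z≤n)) Q

Noetherian : Set₁
Noetherian = (F : ℕ → QSet) → (∀ i → Closed (F i)) → (∀ i → F (suc i) ⊆ F i) →
  ∃ λ m → ∀ k → m ≤ k → F k ≐ F m

ACC : Set₁
ACC = (F : ℕ → QSet) → (∀ i → Closed (F i)) → (∀ i → F i ⊆ F (suc i)) →
  ∃ λ m → ∀ k → m ≤ k → F k ≐ F m

-- Mutation commutes with passing to full subquivers, and on quivers (no loops, no
-- 2-cycles) every mutation is an involution, so mutation equivalence is an equivalence
-- relation. Together these show that if [P] ⪯ [Q] then every quiver of [P] is a full
-- subquiver of some quiver of [Q]. Hence ⪯ is transitive, which makes the [I_{N+1}]-avoiding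
-- classes a down-set, and the arrow bounds defining C_N pass from [Q] down to [P].
-- Two vertices with no arrows between them span I_2, whence C_1 = E_1. The inclusions are
-- strict: on two vertices mutation only reverses arrows, so the Kronecker quiver with N
-- arrows lies in C_N but not C_{N+1}; and I_{N+1} lies in E_{N+1} but not E_N, because an
-- embedding cannot increase the number of vertices. Strict chains contradict ACC and DCC.

module Submission where

open import Defs
open import Data.Nat using (ℕ; suc; _≤_; _+_; _*_; _∸_; s≤s; z≤n)
open import Data.Nat.Properties
  using (+-comm; +-suc; +-identityʳ; *-comm; ≤-total; ≤-trans; ≤-reflexive; n≤1+n; 1+n≰n;
         n≢0⇒n>0; m≤n⇒m∸n≡0; n∸n≡0; 0∸n≡0; [m+n]∸[m+o]≡n∸o; m+n≡0⇒m≡0; m+n≡0⇒n≡0;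
         +-commutativeSemigroup)
open import Algebra.Properties.CommutativeSemigroup +-commutativeSemigroup
  using (x∙yz≈y∙xz; xy∙z≈x∙zy)
open import Data.Empty using (⊥-elim)
open import Data.Fin using (Fin; _≟_; inject₁) renaming (zero to 0F; suc to sucF)
open import Data.Fin.Properties using (inject₁-injective; injective⇒≤)
open import Data.List using (List; []; _∷_; _++_; _∷ʳ_; map; reverse)
open import Data.List.Properties using (unfold-reverse)
open import Data.Product using (Σ; _×_; _,_; proj₁; proj₂)
open import Data.Sum using (_⊎_; inj₁; inj₂)
open import Function using (_∘_; id)
open import Function.Bundles using (_↔_; Inverse; Injection)
open import Function.Definitions using (Injective)
open import Function.Properties.Inverse using (↔-refl; ↔-sym; ↔⇒↣)
open import Function.Construct.Composition using (_↔-∘_)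
open import Relation.Nullary using (¬_; Dec; yes; no)
open import Relation.Binary.PropositionalEquality
  using (_≡_; _≢_; refl; sym; trans; cong; cong₂; subst; module ≡-Reasoning)

open Inverse using (to; from; strictlyInverseˡ)

to-injective : ∀ {A B : Set} (σ : A ↔ B) → Injective _≡_ _≡_ (to σ)
to-injective σ = Injection.injective (↔⇒↣ σ)

from-injective : ∀ {A B : Set} (σ : A ↔ B) → Injective _≡_ _≡_ (from σ)
from-injective σ = to-injective (↔-sym σ)

module _ {n} (k : Fin n) (a : Raw n) where

  mutateRaw-outgoing : ∀ j → mutateRaw k a k j ≡ a j k
  mutateRaw-outgoing j with k ≟ k
  ... | yes _  = refl
  ... | no k≢k = ⊥-elim (k≢k refl)

  mutateRaw-incoming : ∀ i → mutateRaw k a i k ≡ a k i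
  mutateRaw-incoming i with i ≟ k | k ≟ k
  ... | yes _ | _      = refl
  ... | no _  | yes _  = refl
  ... | no _  | no k≢k = ⊥-elim (k≢k refl)

  mutateRaw-away : ∀ {i j} → i ≢ k → j ≢ k →
    mutateRaw k a i j ≡ (a i j + a i k * a k j) ∸ (a j i + a j k * a k i)
  mutateRaw-away {i} {j} i≢k j≢k with i ≟ k | j ≟ k
  ... | yes i≡k | _       = ⊥-elim (i≢k i≡k)
  ... | no _    | yes j≡k = ⊥-elim (j≢k j≡k)
  ... | no _    | no _    = refl

mutateSeq-++ : ∀ {n} (ks ls : List (Fin n)) a →
  mutateSeq (ks ++ ls) a ≡ mutateSeq ls (mutateSeq ks a)
mutateSeq-++ []       ls a = refl
mutateSeq-++ (k ∷ ks) ls a = mutateSeq-++ ks ls (mutateRaw k a)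

mutateSeq-∷ʳ : ∀ {n} (ks : List (Fin n)) k a →
  mutateSeq (ks ∷ʳ k) a ≡ mutateRaw k (mutateSeq ks a)
mutateSeq-∷ʳ ks k a = mutateSeq-++ ks (k ∷ []) a

IsRestriction : ∀ {m n} → (Fin m → Fin n) → Raw m → Raw n → Set
IsRestriction ι a b = ∀ i j → b (ι i) (ι j) ≡ a i j

IsRestriction-∘ : ∀ {l m n} {ι : Fin l → Fin m} {κ : Fin m → Fin n} {a b c} →
  IsRestriction ι a b → IsRestriction κ b c → IsRestriction (κ ∘ ι) a c
IsRestriction-∘ ι-res κ-res i j = trans (κ-res _ _) (ι-res i j)

mutateRaw-restriction : ∀ {m n} {ι : Fin m → Fin n} {a b} → Injective _≡_ _≡_ ι →
  IsRestriction ι a b → ∀ k → IsRestriction ι (mutateRaw k a) (mutateRaw (ι k) b)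
mutateRaw-restriction {ι = ι} {a} {b} ι-inj res k i j = cases (i ≟ k) (j ≟ k)
  where
  open ≡-Reasoning
  cases : Dec (i ≡ k) → Dec (j ≡ k) → mutateRaw (ι k) b (ι i) (ι j) ≡ mutateRaw k a i j
  cases (yes refl) _ = begin
    mutateRaw (ι i) b (ι i) (ι j)  ≡⟨ mutateRaw-outgoing (ι i) b (ι j) ⟩
    b (ι j) (ι i)                  ≡⟨ res j i ⟩
    a j i                          ≡⟨ mutateRaw-outgoing i a j ⟨
    mutateRaw i a i j              ∎
  cases (no _) (yes refl) = begin
    mutateRaw (ι j) b (ι i) (ι j)  ≡⟨ mutateRaw-incoming (ι j) b (ι i) ⟩
    b (ι j) (ι i)                  ≡⟨ res j i ⟩
    a j i                          ≡⟨ mutateRaw-incoming j a i ⟨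
    mutateRaw j a i j              ∎
  cases (no i≢k) (no j≢k) = begin
    mutateRaw (ι k) b (ι i) (ι j)
      ≡⟨ mutateRaw-away (ι k) b (i≢k ∘ ι-inj) (j≢k ∘ ι-inj) ⟩
    (b (ι i) (ι j) + b (ι i) (ι k) * b (ι k) (ι j))
      ∸ (b (ι j) (ι i) + b (ι j) (ι k) * b (ι k) (ι i))
      ≡⟨ cong₂ _∸_ (cong₂ _+_ (res i j) (cong₂ _*_ (res i k) (res k j)))
                   (cong₂ _+_ (res j i) (cong₂ _*_ (res j k) (res k i))) ⟩
    (a i j + a i k * a k j) ∸ (a j i + a j k * a k i)
      ≡⟨ mutateRaw-away k a i≢k j≢k ⟨
    mutateRaw k a i j ∎

mutateSeq-restriction : ∀ {m n} {ι : Fin m → Fin n} {a b} → Injective _≡_ _≡_ ι →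
  IsRestriction ι a b → ∀ ks → IsRestriction ι (mutateSeq ks a) (mutateSeq (map ι ks) b)
mutateSeq-restriction ι-inj res []       = res
mutateSeq-restriction ι-inj res (k ∷ ks) =
  mutateSeq-restriction ι-inj (mutateRaw-restriction ι-inj res k) ks

_≗₂_ : ∀ {n} → Raw n → Raw n → Set
a ≗₂ b = ∀ i j → a i j ≡ b i j

mutateRaw-cong : ∀ {n} (k : Fin n) {a b} → a ≗₂ b → mutateRaw k a ≗₂ mutateRaw k b
mutateRaw-cong k a≗b = mutateRaw-restriction id a≗b k

IsQuiver : ∀ {n} → Raw n → Set
IsQuiver a = (∀ i → a i i ≡ 0) × (∀ i j → a i j ≡ 0 ⊎ a j i ≡ 0)

isQuiver : (Q : Quiver) → IsQuiver (arr Q)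
isQuiver Q = loopless Q , no2cycle Q

mutateRaw-isQuiver : ∀ {n} (k : Fin n) {a : Raw n} → IsQuiver a → IsQuiver (mutateRaw k a)
mutateRaw-isQuiver k {a} (loopless , no2cycle) = loopless′ , no2cycle′
  where
  loopless′ : ∀ i → mutateRaw k a i i ≡ 0
  loopless′ i = cases (i ≟ k)
    where
    cases : Dec (i ≡ k) → mutateRaw k a i i ≡ 0
    cases (yes refl) = trans (mutateRaw-outgoing i a i) (loopless i)
    cases (no i≢k)   = trans (mutateRaw-away k a i≢k i≢k) (n∸n≡0 (a i i + a i k * a k i))
  no2cycle′ : ∀ i j → mutateRaw k a i j ≡ 0 ⊎ mutateRaw k a j i ≡ 0
  no2cycle′ i j = cases (i ≟ k) (j ≟ k) (no2cycle i j)
    where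
    cases : Dec (i ≡ k) → Dec (j ≡ k) → a i j ≡ 0 ⊎ a j i ≡ 0 →
      mutateRaw k a i j ≡ 0 ⊎ mutateRaw k a j i ≡ 0
    cases (yes refl) _ (inj₁ aij≡0) = inj₂ (trans (mutateRaw-incoming i a j) aij≡0)
    cases (yes refl) _ (inj₂ aji≡0) = inj₁ (trans (mutateRaw-outgoing i a j) aji≡0)
    cases (no _) (yes refl) (inj₁ aij≡0) = inj₂ (trans (mutateRaw-outgoing j a i) aij≡0)
    cases (no _) (yes refl) (inj₂ aji≡0) = inj₁ (trans (mutateRaw-incoming j a i) aji≡0)
    cases (no i≢k) (no j≢k) _ with ≤-total (a i j + a i k * a k j) (a j i + a j k * a k i)
    ... | inj₁ ≤ = inj₁ (trans (mutateRaw-away k a i≢k j≢k) (m≤n⇒m∸n≡0 ≤))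
    ... | inj₂ ≥ = inj₂ (trans (mutateRaw-away k a j≢k i≢k) (m≤n⇒m∸n≡0 ≥))

mutateSeq-isQuiver : ∀ {n} (ks : List (Fin n)) {a : Raw n} → IsQuiver a → IsQuiver (mutateSeq ks a)
mutateSeq-isQuiver []       q = q
mutateSeq-isQuiver (k ∷ ks) q = mutateSeq-isQuiver ks (mutateRaw-isQuiver k q)

m∸n+n≡n∸m+m : ∀ m n → m ∸ n + n ≡ n ∸ m + m
m∸n+n≡n∸m+m 0       0       = refl
m∸n+n≡n∸m+m 0       (suc n) = cong suc (sym (+-identityʳ n))
m∸n+n≡n∸m+m (suc m) 0       = cong suc (+-identityʳ m)
m∸n+n≡n∸m+m (suc m) (suc n) =
  trans (+-suc (m ∸ n) n) (trans (cong suc (m∸n+n≡n∸m+m m n)) (sym (+-suc (n ∸ m) m)))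

-- Mutating twice at k sends a i j (i, j ≠ k) to the left-hand side, where A = a i j,
-- B = a j i, p = a i k * a k j and q = a j k * a k i.
mutate-twice-arithmetic : ∀ A B p q →
  ((A + p) ∸ (B + q) + q) ∸ ((B + q) ∸ (A + p) + p) ≡ A ∸ B
mutate-twice-arithmetic A B p q = begin
  (u + q) ∸ (v + p)              ≡⟨ [m+n]∸[m+o]≡n∸o B (u + q) (v + p) ⟨
  (B + (u + q)) ∸ (B + (v + p))  ≡⟨ cong₂ _∸_ shift (+-comm B (v + p)) ⟩
  (v + p + A) ∸ (v + p + B)      ≡⟨ [m+n]∸[m+o]≡n∸o (v + p) A B ⟩
  A ∸ B                          ∎
  where
  open ≡-Reasoning
  u = (A + p) ∸ (B + q)
  v = (B + q) ∸ (A + p)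
  shift : B + (u + q) ≡ v + p + A
  shift = begin
    B + (u + q)  ≡⟨ x∙yz≈y∙xz B u q ⟩
    u + (B + q)  ≡⟨ m∸n+n≡n∸m+m (A + p) (B + q) ⟩
    v + (A + p)  ≡⟨ xy∙z≈x∙zy v p A ⟨
    v + p + A    ∎

mutateRaw-involutive : ∀ {n} (k : Fin n) {a : Raw n} → IsQuiver a →
  mutateRaw k (mutateRaw k a) ≗₂ a
mutateRaw-involutive k {a} (_ , no2cycle) i j = cases (i ≟ k) (j ≟ k)
  where
  open ≡-Reasoning
  b = mutateRaw k a
  cases : Dec (i ≡ k) → Dec (j ≡ k) → mutateRaw k b i j ≡ a i j
  cases (yes refl) _ = trans (mutateRaw-outgoing i b j) (mutateRaw-incoming i a j)
  cases (no _) (yes refl) = trans (mutateRaw-incoming j b i) (mutateRaw-outgoing j a i)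
  cases (no i≢k) (no j≢k) = begin
    mutateRaw k b i j
      ≡⟨ mutateRaw-away k b i≢k j≢k ⟩
    (b i j + b i k * b k j) ∸ (b j i + b j k * b k i)
      ≡⟨ cong₂ _∸_ (cong₂ _+_ (mutateRaw-away k a i≢k j≢k) q-paths)
                   (cong₂ _+_ (mutateRaw-away k a j≢k i≢k) p-paths) ⟩
    ((A + p) ∸ (B + q) + q) ∸ ((B + q) ∸ (A + p) + p)
      ≡⟨ mutate-twice-arithmetic A B p q ⟩
    A ∸ B
      ≡⟨ A∸B≡A (no2cycle i j) ⟩
    A ∎
    where
    A = a i j
    B = a j i
    p = a i k * a k j
    q = a j k * a k i
    q-paths : b i k * b k j ≡ q
    q-paths = trans (cong₂ _*_ (mutateRaw-incoming k a i) (mutateRaw-outgoing k a j))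
                    (*-comm (a k i) (a j k))
    p-paths : b j k * b k i ≡ p
    p-paths = trans (cong₂ _*_ (mutateRaw-incoming k a j) (mutateRaw-outgoing k a i))
                    (*-comm (a k j) (a i k))
    -- Only here are 2-cycles excluded; in general just a i j ∸ a j i comes back.
    A∸B≡A : A ≡ 0 ⊎ B ≡ 0 → A ∸ B ≡ A
    A∸B≡A (inj₁ A≡0) = trans (cong (_∸ B) A≡0) (trans (0∸n≡0 B) (sym A≡0))
    A∸B≡A (inj₂ B≡0) = cong (A ∸_) B≡0

mutateSeq-reverse-inverse : ∀ {n} (ks : List (Fin n)) {a : Raw n} → IsQuiver a →
  mutateSeq (reverse ks) (mutateSeq ks a) ≗₂ a
mutateSeq-reverse-inverse []       q i j = refl
mutateSeq-reverse-inverse (k ∷ ks) {a} q i j = begin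
  mutateSeq (reverse (k ∷ ks)) c i j
    ≡⟨ cong (λ ls → mutateSeq ls c i j) (unfold-reverse k ks) ⟩
  mutateSeq (reverse ks ∷ʳ k) c i j
    ≡⟨ cong (λ d → d i j) (mutateSeq-∷ʳ (reverse ks) k c) ⟩
  mutateRaw k (mutateSeq (reverse ks) c) i j
    ≡⟨ mutateRaw-cong k (mutateSeq-reverse-inverse ks (mutateRaw-isQuiver k q)) i j ⟩
  mutateRaw k (mutateRaw k a) i j
    ≡⟨ mutateRaw-involutive k q i j ⟩
  a i j ∎
  where
  open ≡-Reasoning
  c = mutateSeq ks (mutateRaw k a)

RawIso-sym : ∀ {m n} {a : Raw m} {b : Raw n} → RawIso a b → RawIso b a
RawIso-sym {b = b} (σ , σ-res) = ↔-sym σ , λ i j →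
  trans (sym (σ-res (from σ i) (from σ j))) (cong₂ b (strictlyInverseˡ σ i) (strictlyInverseˡ σ j))

RawIso-trans : ∀ {l m n} {a : Raw l} {b : Raw m} {c : Raw n} →
  RawIso a b → RawIso b c → RawIso a c
RawIso-trans {b = b} {c} (σ , σ-res) (ρ , ρ-res) =
  ρ ↔-∘ σ , IsRestriction-∘ {κ = to ρ} {b = b} {c = c} σ-res ρ-res

RawIso-respˡ : ∀ {m n} {a a′ : Raw m} {b : Raw n} → a ≗₂ a′ → RawIso a b → RawIso a′ b
RawIso-respˡ a≗a′ (σ , σ-res) = σ , λ i j → trans (σ-res i j) (a≗a′ i j)

MutEq-refl : ∀ Q → MutEq Q Q
MutEq-refl Q = [] , ↔-refl , λ _ _ → refl

MutEq-sym : ∀ {P Q} → MutEq P Q → MutEq Q P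
MutEq-sym {P} {Q} (ks , σ , σ-res) = map (to σ) (reverse ks) , RawIso-sym P≅Q′
  where
  Q′ = mutateSeq (map (to σ) (reverse ks)) (arr Q)
  P≅Q′ : RawIso (arr P) Q′
  P≅Q′ = RawIso-respˡ {b = Q′} (mutateSeq-reverse-inverse ks (isQuiver P))
    (σ , mutateSeq-restriction {b = arr Q} (to-injective σ) σ-res (reverse ks))

MutEq-trans : ∀ {P Q R} → MutEq P Q → MutEq Q R → MutEq P R
MutEq-trans {P} {Q} {R} (ks , P′≅Q) (ls , Q′≅R) =
  ks ++ ls′ , subst (λ d → RawIso d (arr R)) (sym (mutateSeq-++ ks ls′ (arr P)))
                (RawIso-trans {c = arr R} P″≅Q′ Q′≅R)
  where
  σ   = proj₁ P′≅Q
  ls′ = map (from σ) ls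
  P′  = mutateSeq ks (arr P)
  P″≅Q′ : RawIso (mutateSeq ls′ P′) (mutateSeq ls (arr Q))
  P″≅Q′ = RawIso-sym (↔-sym σ , mutateSeq-restriction {b = P′} (from-injective σ)
                                  (proj₂ (RawIso-sym P′≅Q)) ls)

mutateQuiver : (Q : Quiver) → List (Fin (size Q)) → Quiver
mutateQuiver Q ks = mkQuiver (size Q) (nonEmpty Q) (mutateSeq ks (arr Q)) (proj₁ q) (proj₂ q)
  where q = mutateSeq-isQuiver ks (isQuiver Q)

MutEq-mutateQuiver : ∀ Q ks → MutEq Q (mutateQuiver Q ks)
MutEq-mutateQuiver Q ks = ks , ↔-refl , λ _ _ → refl

RawIso⇒IsoFullSub : ∀ {P Q} → RawIso (arr P) (arr Q) → IsoFullSub P Q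
RawIso⇒IsoFullSub (σ , σ-res) = to σ , to-injective σ , σ-res

IsoFullSub-trans : ∀ {P Q R} → IsoFullSub P Q → IsoFullSub Q R → IsoFullSub P R
IsoFullSub-trans {Q = Q} {R} (ι , ι-inj , ι-res) (κ , κ-inj , κ-res) =
  κ ∘ ι , ι-inj ∘ κ-inj , IsRestriction-∘ {κ = κ} {b = arr Q} {c = arr R} ι-res κ-res

IsoFullSub-mutate : ∀ {P Q P′} → IsoFullSub P Q → MutEq P P′ →
  Σ Quiver λ Q′ → MutEq Q Q′ × IsoFullSub P′ Q′
IsoFullSub-mutate {P} {Q} {P′} (ι , ι-inj , ι-res) (ks , iso) =
  mutateQuiver Q (map ι ks) , MutEq-mutateQuiver Q (map ι ks) ,
  IsoFullSub-trans {P′} {mutateQuiver P ks} {mutateQuiver Q (map ι ks)}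
    (RawIso⇒IsoFullSub {P′} {mutateQuiver P ks} (RawIso-sym iso))
    (ι , ι-inj , mutateSeq-restriction ι-inj ι-res ks)

Embeds-mutate : ∀ {P Q P″} → Embeds P Q → MutEq P P″ →
  Σ Quiver λ Q″ → MutEq Q Q″ × IsoFullSub P″ Q″
Embeds-mutate {P} {Q} {P″} (P′ , Q′ , P~P′ , Q~Q′ , P′⊆Q′) P~P″
  with IsoFullSub-mutate {P′} {Q′} {P″} P′⊆Q′
         (MutEq-trans {P′} {P} {P″} (MutEq-sym {P} {P′} P~P′) P~P″)
... | Q″ , Q′~Q″ , P″⊆Q″ = Q″ , MutEq-trans {Q} {Q′} {Q″} Q~Q′ Q′~Q″ , P″⊆Q″

Embeds⇒IsoFullSub : ∀ {P Q} → Embeds P Q → Σ Quiver λ Q′ → MutEq Q Q′ × IsoFullSub P Q′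
Embeds⇒IsoFullSub {P} {Q} P⪯Q = Embeds-mutate {P} {Q} {P} P⪯Q (MutEq-refl P)

IsoFullSub⇒Embeds : ∀ {P Q Q′} → MutEq Q Q′ → IsoFullSub P Q′ → Embeds P Q
IsoFullSub⇒Embeds {P} {Q} {Q′} Q~Q′ P⊆Q′ = P , Q′ , MutEq-refl P , Q~Q′ , P⊆Q′

Embeds-refl : ∀ Q → Embeds Q Q
Embeds-refl Q = IsoFullSub⇒Embeds {Q} {Q} {Q} (MutEq-refl Q) (id , id , λ _ _ → refl)

Embeds-trans : ∀ {P Q R} → Embeds P Q → Embeds Q R → Embeds P R
Embeds-trans {P} {Q} {R} P⪯Q Q⪯R with Embeds⇒IsoFullSub {P} {Q} P⪯Q
... | Q′ , Q~Q′ , P⊆Q′ with Embeds-mutate {Q} {R} {Q′} Q⪯R Q~Q′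
...   | R′ , R~R′ , Q′⊆R′ =
  IsoFullSub⇒Embeds {P} {R} {R′} R~R′ (IsoFullSub-trans {P} {Q′} {R′} P⊆Q′ Q′⊆R′)

Embeds⇒size≤ : ∀ {P Q} → Embeds P Q → size P ≤ size Q
Embeds⇒size≤ {P} {Q} P⪯Q with Embeds⇒IsoFullSub {P} {Q} P⪯Q
... | _ , (_ , σ , _) , ι , ι-inj , _ = injective⇒≤ {f = from σ ∘ ι} (ι-inj ∘ from-injective σ)

I[1+_] : ℕ → Quiver
I[1+ n ] = emptyQuiver (suc n) (s≤s z≤n)

C-closed : ∀ N → Closed (C N)
C-closed N P Q P⪯Q Q∈C P′ P~P′ i j i≢j with Embeds-mutate {P} {Q} {P′} P⪯Q P~P′
... | Q′ , Q~Q′ , ι , ι-inj , ι-res =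
  subst (N ≤_) (cong₂ _+_ (ι-res i j) (ι-res j i)) (Q∈C Q′ Q~Q′ (ι i) (ι j) (i≢j ∘ ι-inj))

E-closed : ∀ N → Closed (E N)
E-closed N P Q P⪯Q Q∈E I⪯P = Q∈E (Embeds-trans {I[1+ N ]} {P} {Q} I⪯P P⪯Q)

unlinked-pair : ∀ Q {i j} → i ≢ j → arr Q i j ≡ 0 → arr Q j i ≡ 0 → IsoFullSub I[1+ 1 ] Q
unlinked-pair Q {i} {j} i≢j ij≡0 ji≡0 = pair , pair-injective , pair-unlinked
  where
  pair : Fin 2 → Fin (size Q)
  pair 0F       = i
  pair (sucF _) = j
  pair-injective : Injective _≡_ _≡_ pair
  pair-injective {0F}      {0F}      _ = refl
  pair-injective {0F}      {sucF 0F} e = ⊥-elim (i≢j e)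
  pair-injective {sucF 0F} {0F}      e = ⊥-elim (i≢j (sym e))
  pair-injective {sucF 0F} {sucF 0F} _ = refl
  pair-unlinked : ∀ x y → arr Q (pair x) (pair y) ≡ 0
  pair-unlinked 0F        0F        = loopless Q i
  pair-unlinked 0F        (sucF 0F) = ij≡0
  pair-unlinked (sucF 0F) 0F        = ji≡0
  pair-unlinked (sucF 0F) (sucF 0F) = loopless Q j

C1⊆E1 : C 1 ⊆ E 1
C1⊆E1 Q Q∈C I⪯Q with Embeds⇒IsoFullSub {I[1+ 1 ]} {Q} I⪯Q
... | Q′ , Q~Q′ , ι , ι-inj , ι-res =
  1+n≰n (subst (1 ≤_) (cong₂ _+_ (ι-res 0F 1F) (ι-res 1F 0F))
               (Q∈C Q′ Q~Q′ (ι 0F) (ι 1F) (0≢1 ∘ ι-inj)))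
  where
  1F : Fin 2
  1F = sucF 0F
  0≢1 : 0F ≢ 1F
  0≢1 ()

E1⊆C1 : E 1 ⊆ C 1
E1⊆C1 Q Q∈E Q′ Q~Q′ i j i≢j = n≢0⇒n>0 λ links≡0 →
  Q∈E (IsoFullSub⇒Embeds {I[1+ 1 ]} {Q} {Q′} Q~Q′
        (unlinked-pair Q′ i≢j (m+n≡0⇒m≡0 _ links≡0) (m+n≡0⇒n≡0 _ links≡0)))

kronecker : ℕ → Raw 2
kronecker N (sucF 0F) 0F = N
kronecker N _         _  = 0

Kronecker : ℕ → Quiver
Kronecker N = mkQuiver 2 (s≤s z≤n) (kronecker N) loopless′ no2cycle′
  where
  loopless′ : ∀ i → kronecker N i i ≡ 0
  loopless′ 0F        = refl
  loopless′ (sucF 0F) = refl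
  no2cycle′ : ∀ i j → kronecker N i j ≡ 0 ⊎ kronecker N j i ≡ 0
  no2cycle′ 0F        _ = inj₁ refl
  no2cycle′ (sucF 0F) 0F        = inj₂ refl
  no2cycle′ (sucF 0F) (sucF 0F) = inj₂ refl

links : Raw 2 → ℕ
links a = a 0F (sucF 0F) + a (sucF 0F) 0F

links-mutateRaw : ∀ k a → links (mutateRaw k a) ≡ links a
links-mutateRaw 0F        a = +-comm (a (sucF 0F) 0F) (a 0F (sucF 0F))
links-mutateRaw (sucF 0F) a = +-comm (a (sucF 0F) 0F) (a 0F (sucF 0F))

links-mutateSeq : ∀ ks a → links (mutateSeq ks a) ≡ links a
links-mutateSeq []       a = refl
links-mutateSeq (k ∷ ks) a = trans (links-mutateSeq ks (mutateRaw k a)) (links-mutateRaw k a)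

links-distinct : ∀ (a : Raw 2) {x y} → x ≢ y → a x y + a y x ≡ links a
links-distinct a {0F}      {0F}      x≢y = ⊥-elim (x≢y refl)
links-distinct a {0F}      {sucF 0F} _   = refl
links-distinct a {sucF 0F} {0F}      _   = +-comm (a (sucF 0F) 0F) (a 0F (sucF 0F))
links-distinct a {sucF 0F} {sucF 0F} x≢y = ⊥-elim (x≢y refl)

Kronecker∈C : ∀ N → C N (Kronecker N)
Kronecker∈C N Q′ (ks , iso) i j i≢j = ≤-reflexive (sym (begin
  arr Q′ i j + arr Q′ j i                    ≡⟨ cong₂ _+_ (τ-res i j) (τ-res j i) ⟨
  b (to τ i) (to τ j) + b (to τ j) (to τ i)  ≡⟨ links-distinct b (i≢j ∘ to-injective τ) ⟩
  links b                                    ≡⟨ links-mutateSeq ks (kronecker N) ⟩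
  N                                          ∎))
  where
  open ≡-Reasoning
  b = mutateSeq ks (kronecker N)
  τ = proj₁ (RawIso-sym {b = arr Q′} iso)
  τ-res : IsRestriction (to τ) (arr Q′) b
  τ-res = proj₂ (RawIso-sym {b = arr Q′} iso)

Kronecker∉C : ∀ N → ¬ C (suc N) (Kronecker N)
Kronecker∉C N K∈C = 1+n≰n (K∈C (Kronecker N) (MutEq-refl (Kronecker N)) 0F (sucF 0F) (λ ()))

C-strict : ∀ N → C (suc N) ⊊ C N
C-strict N = C-suc⊆C , Kronecker N , Kronecker∈C N , Kronecker∉C N
  where
  C-suc⊆C : C (suc N) ⊆ C N
  C-suc⊆C Q Q∈C Q′ Q~Q′ i j i≢j = ≤-trans (n≤1+n N) (Q∈C Q′ Q~Q′ i j i≢j)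

E-strict : ∀ N → E N ⊊ E (suc N)
E-strict N = E⊆E-suc , I[1+ N ] , I[1+N]∈E[1+N] , λ I[1+N]∈E[N] → I[1+N]∈E[N] (Embeds-refl I[1+ N ])
  where
  I[1+N]⪯I[2+N] : Embeds I[1+ N ] I[1+ suc N ]
  I[1+N]⪯I[2+N] = IsoFullSub⇒Embeds {I[1+ N ]} {I[1+ suc N ]} {I[1+ suc N ]}
    (MutEq-refl I[1+ suc N ]) (inject₁ , inject₁-injective , λ _ _ → refl)
  E⊆E-suc : E N ⊆ E (suc N)
  E⊆E-suc Q Q∈E I⪯Q = Q∈E (Embeds-trans {I[1+ N ]} {I[1+ suc N ]} {Q} I[1+N]⪯I[2+N] I⪯Q)
  I[1+N]∈E[1+N] : E (suc N) I[1+ N ]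
  I[1+N]∈E[1+N] I⪯I = 1+n≰n (Embeds⇒size≤ {I[1+ suc N ]} {I[1+ N ]} I⪯I)

strictlyAscending⇒¬ACC : (F : ℕ → QSet) → (∀ i → Closed (F i)) →
  (∀ i → F i ⊊ F (suc i)) → ¬ ACC
strictlyAscending⇒¬ACC F closed strict acc with acc F closed (proj₁ ∘ strict)
... | m , stable with strict m
...   | _ , Q , Q∈F[1+m] , Q∉F[m] = Q∉F[m] (proj₁ (stable (suc m) (n≤1+n m)) Q Q∈F[1+m])

strictlyDescending⇒¬Noetherian : (F : ℕ → QSet) → (∀ i → Closed (F i)) →
  (∀ i → F (suc i) ⊊ F i) → ¬ Noetherian
strictlyDescending⇒¬Noetherian F closed strict noetherian with noetherian F closed (proj₁ ∘ strict)
... | m , stable with strict m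
...   | _ , Q , Q∈F[m] , Q∉F[1+m] = Q∉F[1+m] (proj₂ (stable (suc m) (n≤1+n m)) Q Q∈F[m])

proposition3p19 :
    (∀ N → 1 ≤ N → Closed (C N)) ×
    (∀ N → 1 ≤ N → Closed (E N)) ×
    (C 1 ≐ E 1) ×
    (∀ N → 1 ≤ N → C (suc N) ⊊ C N) ×
    (∀ N → 1 ≤ N → E N ⊊ E (suc N)) ×
    ¬ ACC × ¬ Noetherian
proposition3p19 =
  (λ N _ → C-closed N) , (λ N _ → E-closed N) , (C1⊆E1 , E1⊆C1) ,
  (λ N _ → C-strict N) , (λ N _ → E-strict N) ,
  strictlyAscending⇒¬ACC E E-closed E-strict ,
  strictlyDescending⇒¬Noetherian C C-closed C-strict
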